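{- Let $a$ be a name. For any number $k$, there exists $n$ such that the equation $a.a^n=a^{n+1}$ is not derivable in equational logic from $\mathcal D_k$.
   Context: MicroCCS terms: $\eta ::= a\mid\overline a$ for names $a$, $M::=\mathbf 0\mid\eta.M\mid M|M\mid X$ with $X$ a variable. $a^n$ denotes the $n$-fold parallel composition of $a.\mathbf 0$, and $R^k$ in general the $k$-fold parallel composition of $R$. $\mathcal D_k$ is the set of equations consisting of $X|Y=Y|X$, $X|(Y|Z)=(X|Y)|Z$, $X|\mathbf 0=X$, and, for $1\le i\le k$ and each prefix $\eta$, $(D_i)\ \eta.(X|(\eta.X)^i)=(\eta.X)^{i+1}$. Derivability is in equational logic. -}

module Defs where

open import Data.Nat using (ℕ; zero; suc; _≤_)

Name : Set
Name = ℕ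

Var : Set
Var = ℕ

data Prefix : Set where
  inp : Name → Prefix
  out : Name → Prefix

infixr 7 _·_
infixl 6 _∥_
data Term : Set where
  𝟎   : Term
  _·_ : Prefix → Term → Term
  _∥_ : Term → Term → Term
  var : Var → Term

pow : Term → ℕ → Term
pow R zero          = 𝟎
pow R (suc zero)    = R
pow R (suc (suc k)) = R ∥ pow R (suc k)

aPow : Name → ℕ → Term
aPow a n = pow (inp a · 𝟎) n

Subst : Set
Subst = Var → Term

sub : Subst → Term → Term
sub σ 𝟎       = 𝟎
sub σ (η · M) = η · sub σ M
sub σ (M ∥ N) = sub σ M ∥ sub σ N
sub σ (var x) = σ x

Equations : Set₁
Equations = Term → Term → Set

X Y Z : Term
X = var 0
Y = var 1
Z = var 2

data D (k : ℕ) : Equations where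
  comm  : D k (X ∥ Y) (Y ∥ X)
  assoc : D k (X ∥ (Y ∥ Z)) ((X ∥ Y) ∥ Z)
  unit  : D k (X ∥ 𝟎) X
  Di    : (i : ℕ) → 1 ≤ i → i ≤ k → (η : Prefix) →
          D k (η · (X ∥ pow (η · X) i)) (pow (η · X) (suc i))

infix 4 _⊢_≈_
data _⊢_≈_ (E : Equations) : Term → Term → Set where
  ax    : ∀ {l r} → E l r → (σ : Subst) → E ⊢ sub σ l ≈ sub σ r
  refl  : ∀ {M} → E ⊢ M ≈ M
  sym   : ∀ {M N} → E ⊢ M ≈ N → E ⊢ N ≈ M
  trans : ∀ {M N P} → E ⊢ M ≈ N → E ⊢ N ≈ P → E ⊢ M ≈ P
  pre   : ∀ (η : Prefix) {M N} → E ⊢ M ≈ N → E ⊢ η · M ≈ η · N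
  par   : ∀ {M M' N N'} → E ⊢ M ≈ M' → E ⊢ N ≈ N' → E ⊢ M ∥ N ≈ M' ∥ N'

-- Interpret a term by a "tick count": 0 counts 0, parallel composition adds,
-- and a prefix adds one tick, except that a prefix completing a count that is
-- not coprime to N = (k+1)! + 1 yields an absorbing error. Both sides of D_i
-- complete the count (i+1)(x+1), and multiplying by i+1 ≤ k+1 preserves
-- coprimality to N because i+1 divides (k+1)!, so D_k is sound for this model.
-- On a.a^n with n = (k+1)! the last prefix completes the count N, giving an
-- error, whereas every prefix of a^(n+1) completes the count 1.
module Submission where

open import Algebra.Definitions using (Associative; Commutative; RightIdentity)
open import Data.Maybe using (Maybe; just; nothing; map; zipWith)
open import Data.Nat using (ℕ; zero; suc; _+_; _*_; _≤_; _<_; _!; z≤n; s≤s)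
open import Data.Nat.Base using (≢-nonZero⁻¹)
open import Data.Nat.Coprimality using (Coprime; coprime?; coprime-divisor; 1-coprimeTo)
open import Data.Nat.Divisibility using (_∣_; ∣-refl; ∣-trans; ∣1⇒≡1; ∣m+n∣m⇒∣n; m∣m*n; m≤n⇒m!∣n!)
open import Data.Nat.Properties using (+-comm; +-assoc; +-identityʳ; *-identityˡ; *-identityʳ; suc-injective; _!≢0)
open import Data.Bool using (if_then_else_)
open import Data.Product using (∃-syntax; _,_)
open import Function using (_∘_)
open import Relation.Nullary using (¬_; does; yes; no)
open import Relation.Nullary.Decidable using (dec-true; dec-false)
open import Relation.Unary using (Decidable)
open import Relation.Binary.PropositionalEquality as ≡ using (_≡_; refl; cong; cong₂; module ≡-Reasoning)

open import Defs

∣⇒coprime-suc : ∀ {m n} → m ∣ n → Coprime m (suc n)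
∣⇒coprime-suc {n = n} m∣n {d} (d∣m , d∣1+n) =
  ∣1⇒≡1 (∣m+n∣m⇒∣n (≡.subst (d ∣_) (+-comm 1 n) d∣1+n) (∣-trans d∣m m∣n))

coprime-* : ∀ {m o n} → Coprime m n → Coprime o n → Coprime (m * o) n
coprime-* {m} m⊥n o⊥n {d} (d∣m*o , d∣n) = o⊥n (coprime-divisor d⊥m d∣m*o , d∣n)
  where
  d⊥m : Coprime d m
  d⊥m (e∣d , e∣m) = m⊥n (e∣m , ∣-trans e∣d d∣n)

coprime-self⇒≡1 : ∀ {n} → Coprime n n → n ≡ 1
coprime-self⇒≡1 n⊥n = n⊥n (∣-refl , ∣-refl)

m<n⇒coprime[1+m,1+n!] : ∀ {m n} → m < n → Coprime (suc m) (suc (n !))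
m<n⇒coprime[1+m,1+n!] {m} m<n = ∣⇒coprime-suc (∣-trans (m∣m*n (m !)) (m≤n⇒m!∣n! m<n))

MulClosedUpTo : ℕ → (ℕ → Set) → Set
MulClosedUpTo b G = ∀ {m x} → 2 ≤ m → m ≤ b → G x → G (m * x)

module Semantics {A : Set} (ε : A) (_⊕_ : A → A → A) (act : Prefix → A → A) where

  ⟦_⟧ : Term → (Var → A) → A
  ⟦ 𝟎 ⟧     ρ = ε
  ⟦ η · t ⟧ ρ = act η (⟦ t ⟧ ρ)
  ⟦ s ∥ t ⟧ ρ = ⟦ s ⟧ ρ ⊕ ⟦ t ⟧ ρ
  ⟦ var v ⟧ ρ = ρ v

  ⟦sub⟧ : ∀ σ t ρ → ⟦ sub σ t ⟧ ρ ≡ ⟦ t ⟧ (λ v → ⟦ σ v ⟧ ρ)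
  ⟦sub⟧ σ 𝟎       ρ = refl
  ⟦sub⟧ σ (η · t) ρ = cong (act η) (⟦sub⟧ σ t ρ)
  ⟦sub⟧ σ (s ∥ t) ρ = cong₂ _⊕_ (⟦sub⟧ σ s ρ) (⟦sub⟧ σ t ρ)
  ⟦sub⟧ σ (var v) ρ = refl

  Satisfies : Equations → Set
  Satisfies E = ∀ {l r} → E l r → ∀ ρ → ⟦ l ⟧ ρ ≡ ⟦ r ⟧ ρ

  soundness : ∀ {E s t} → Satisfies E → E ⊢ s ≈ t → ∀ ρ → ⟦ s ⟧ ρ ≡ ⟦ t ⟧ ρ
  soundness sat (ax {l} {r} e σ) ρ =
    ≡.trans (⟦sub⟧ σ l ρ) (≡.trans (sat e _) (≡.sym (⟦sub⟧ σ r ρ)))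
  soundness sat refl        ρ = refl
  soundness sat (sym d)     ρ = ≡.sym (soundness sat d ρ)
  soundness sat (trans d e) ρ = ≡.trans (soundness sat d ρ) (soundness sat e ρ)
  soundness sat (pre η d)   ρ = cong (act η) (soundness sat d ρ)
  soundness sat (par d e)   ρ = cong₂ _⊕_ (soundness sat d ρ) (soundness sat e ρ)

module _ {A : Set} {f : A → A → A} where

  zipWith-comm : Commutative _≡_ f → Commutative _≡_ (zipWith f)
  zipWith-comm f-comm nothing  nothing  = refl
  zipWith-comm f-comm nothing  (just y) = refl
  zipWith-comm f-comm (just x) nothing  = refl
  zipWith-comm f-comm (just x) (just y) = cong just (f-comm x y)

  zipWith-assoc : Associative _≡_ f → Associative _≡_ (zipWith f)
  zipWith-assoc f-assoc nothing  m        o        = refl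
  zipWith-assoc f-assoc (just x) nothing  o        = refl
  zipWith-assoc f-assoc (just x) (just y) nothing  = refl
  zipWith-assoc f-assoc (just x) (just y) (just z) = cong just (f-assoc x y z)

  zipWith-identityʳ : ∀ {e} → RightIdentity _≡_ e f → RightIdentity _≡_ (just e) (zipWith f)
  zipWith-identityʳ idʳ nothing  = refl
  zipWith-identityʳ idʳ (just x) = cong just (idʳ x)

module TickModel {G : ℕ → Set} (G? : Decidable G) where

  admit : ℕ → Maybe ℕ
  admit n = if does (G? n) then just n else nothing

  admit-yes : ∀ {n} → G n → admit n ≡ just n
  admit-yes {n} g = cong (if_then just n else nothing) (dec-true (G? n) g)

  admit-no : ∀ {n} → ¬ G n → admit n ≡ nothing
  admit-no {n} ¬g = cong (if_then just n else nothing) (dec-false (G? n) ¬g)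

  tick : Maybe ℕ → Maybe ℕ
  tick nothing  = nothing
  tick (just x) = admit (suc x)

  _⊕_ : Maybe ℕ → Maybe ℕ → Maybe ℕ
  _⊕_ = zipWith _+_

  open Semantics (just 0) _⊕_ (λ _ → tick) public

  ⟦pow-suc⟧ : ∀ t i ρ → ⟦ pow t (suc i) ⟧ ρ ≡ map (suc i *_) (⟦ t ⟧ ρ)
  ⟦pow-suc⟧ t zero ρ with ⟦ t ⟧ ρ
  ... | nothing = refl
  ... | just y  = cong just (≡.sym (*-identityˡ y))
  ⟦pow-suc⟧ t (suc i) ρ rewrite ⟦pow-suc⟧ t i ρ with ⟦ t ⟧ ρ
  ... | nothing = refl
  ... | just y  = refl

  tick-⊕-multiple : ∀ {i} → (∀ {x} → G x → G (suc (suc i) * x)) →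
                    ∀ m → tick (m ⊕ map (suc i *_) (tick m)) ≡ map (suc (suc i) *_) (tick m)
  tick-⊕-multiple closed nothing  = refl
  tick-⊕-multiple closed (just x) with G? (suc x)
  -- suc (x + suc i * suc x) is suc (suc i) * suc x by computation
  ... | yes g = admit-yes (closed g)
  ... | no  _ = refl

  satisfies-D : ∀ {k} → MulClosedUpTo (suc k) G → Satisfies (D k)
  satisfies-D closed comm  ρ = zipWith-comm +-comm (ρ 0) (ρ 1)
  satisfies-D closed assoc ρ = ≡.sym (zipWith-assoc +-assoc (ρ 0) (ρ 1) (ρ 2))
  satisfies-D closed unit  ρ = zipWith-identityʳ +-identityʳ (ρ 0)
  satisfies-D closed (Di zero () _ _)
  satisfies-D closed (Di (suc i) _ i≤k η) ρ = begin
    tick (ρ 0 ⊕ ⟦ pow (η · X) (suc i) ⟧ ρ)     ≡⟨ cong (tick ∘ (ρ 0 ⊕_)) (⟦pow-suc⟧ (η · X) i ρ) ⟩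
    tick (ρ 0 ⊕ map (suc i *_) (tick (ρ 0)))  ≡⟨ tick-⊕-multiple {i} (closed (s≤s (s≤s z≤n)) (s≤s i≤k)) (ρ 0) ⟩
    map (suc (suc i) *_) (tick (ρ 0))         ≡⟨ ⟦pow-suc⟧ (η · X) (suc i) ρ ⟨
    ⟦ pow (η · X) (suc (suc i)) ⟧ ρ           ∎
    where open ≡-Reasoning

  ⟦aPow⟧ : G 1 → ∀ a n ρ → ⟦ aPow a n ⟧ ρ ≡ just n
  ⟦aPow⟧ g a zero    ρ = refl
  ⟦aPow⟧ g a (suc n) ρ = begin
    ⟦ aPow a (suc n) ⟧ ρ     ≡⟨ ⟦pow-suc⟧ (inp a · 𝟎) n ρ ⟩
    map (suc n *_) (admit 1)  ≡⟨ cong (map (suc n *_)) (admit-yes g) ⟩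
    just (suc n * 1)          ≡⟨ cong just (*-identityʳ (suc n)) ⟩
    just (suc n)              ∎
    where open ≡-Reasoning

  not-derivable : ∀ {k n} a → MulClosedUpTo (suc k) G →
                  G 1 → ¬ G (suc n) → ¬ (D k ⊢ inp a · aPow a n ≈ aPow a (suc n))
  not-derivable {n = n} a closed g1 ¬g d = nothing≢just (begin
      nothing                  ≡⟨ admit-no ¬g ⟨
      tick (just n)            ≡⟨ cong tick (⟦aPow⟧ g1 a n ρ) ⟨
      ⟦ inp a · aPow a n ⟧ ρ   ≡⟨ soundness (satisfies-D closed) d ρ ⟩
      ⟦ aPow a (suc n) ⟧ ρ     ≡⟨ ⟦aPow⟧ g1 a (suc n) ρ ⟩
      just (suc n)             ∎)
    where
    open ≡-Reasoning
    ρ : Var → Maybe ℕ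
    ρ _ = nothing
    nothing≢just : ∀ {x : ℕ} → ¬ nothing ≡ just x
    nothing≢just ()

lemma3p8 : (a : Name) (k : ℕ) →
    ∃[ n ] ¬ (D k ⊢ inp a · aPow a n ≈ aPow a (suc n))
lemma3p8 a k = suc k ! , not-derivable a closed (1-coprimeTo N) N⊥̸N
  where
  N : ℕ
  N = suc (suc k !)

  open TickModel (λ x → coprime? x N)

  closed : MulClosedUpTo (suc k) (λ x → Coprime x N)
  closed {suc m} _ m<1+k x⊥N = coprime-* (m<n⇒coprime[1+m,1+n!] m<1+k) x⊥N

  N⊥̸N : ¬ Coprime N N
  N⊥̸N N⊥N = ≢-nonZero⁻¹ (suc k !) {{suc k !≢0}} (suc-injective (coprime-self⇒≡1 N⊥N))
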